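{- If $H$ is a subgraph of a graph $G$, then $\Psi(H)\le\Psi(G)$.
   Context: All graphs are finite and simple. A matching of a graph $G$ is a set of edges no two of which share a vertex; it is maximal if it is not a proper subset of another matching of $G$. $\Psi(G)$ denotes the number of maximal matchings of $G$. -}

module Defs where

open import Data.Bool using (Bool; true; false)
open import Data.Nat using (ℕ)
open import Data.Fin using (Fin; _<?_)
open import Data.Fin.Properties using (_≟_)
open import Data.Product using (_×_; _,_; proj₁; proj₂)
open import Data.Product.Properties using (≡-dec)
open import Data.List using (List; []; _∷_; map; _++_; filter; length; allFin; cartesianProduct)
open import Data.List.Relation.Unary.All using (All; all?)
open import Data.List.Relation.Unary.AllPairs using (AllPairs; allPairs?)
open import Data.List.Membership.DecPropositional using ()
import Data.List.Membership.Propositional as Mem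
open import Relation.Nullary using (Dec; ¬_; ¬?; _×-dec_; _→-dec_)
open import Relation.Binary.PropositionalEquality using (_≡_; _≢_)
open import Data.Bool.Properties using () renaming (_≟_ to _≟B_)
open import Function using (Injective)

record Graph (n : ℕ) : Set where
  field
    adj     : Fin n → Fin n → Bool
    symm    : ∀ i j → adj i j ≡ adj j i
    irrefl  : ∀ i → adj i i ≡ false
open Graph public

Edge : ℕ → Set
Edge n = Fin n × Fin n

-- The edge set of G, each edge {i,j} listed exactly once as (i , j) with i < j.
edges : ∀ {n} → Graph n → List (Edge n)
edges {n} G = filter (λ e → (proj₁ e <? proj₂ e) ×-dec (adj G (proj₁ e) (proj₂ e) ≟B true))
                     (cartesianProduct (allFin n) (allFin n))

sublists : ∀ {A : Set} → List A → List (List A)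
sublists []       = [] ∷ []
sublists (x ∷ xs) = let r = sublists xs in r ++ map (x ∷_) r

Disjoint : ∀ {n} → Edge n → Edge n → Set
Disjoint (a , b) (c , d) = (a ≢ c) × (a ≢ d) × (b ≢ c) × (b ≢ d)

disjoint? : ∀ {n} (e f : Edge n) → Dec (Disjoint e f)
disjoint? (a , b) (c , d) =
  ¬? (a ≟ c) ×-dec ¬? (a ≟ d) ×-dec ¬? (b ≟ c) ×-dec ¬? (b ≟ d)

IsMatching : ∀ {n} → List (Edge n) → Set
IsMatching M = AllPairs Disjoint M

isMatching? : ∀ {n} (M : List (Edge n)) → Dec (IsMatching M)
isMatching? M = allPairs? disjoint? M

_∈E_ : ∀ {n} → Edge n → List (Edge n) → Set
e ∈E M = Mem._∈_ e M

_⊆E_ : ∀ {n} → List (Edge n) → List (Edge n) → Set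
M ⊆E M' = All (λ e → e ∈E M') M

⊆E? : ∀ {n} (M M' : List (Edge n)) → Dec (M ⊆E M')
⊆E? {n} M M' = all? (λ e → Data.List.Membership.DecPropositional._∈?_ (≡-dec _≟_ _≟_) e M') M

IsMaximalMatching : ∀ {n} → Graph n → List (Edge n) → Set
IsMaximalMatching G M =
  IsMatching M × All (λ M' → IsMatching M' → M ⊆E M' → M' ⊆E M) (sublists (edges G))

isMaximalMatching? : ∀ {n} (G : Graph n) (M : List (Edge n)) → Dec (IsMaximalMatching G M)
isMaximalMatching? G M =
  isMatching? M ×-dec all? (λ M' → isMatching? M' →-dec (⊆E? M M' →-dec ⊆E? M' M)) (sublists (edges G))

Ψ : ∀ {n} → Graph n → ℕ
Ψ G = length (filter (isMaximalMatching? G) (sublists (edges G)))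

-- H is a subgraph of G (up to isomorphism): an injective vertex map
-- sending edges of H to edges of G.
_IsSubgraphOf_ : ∀ {m n} → Graph m → Graph n → Set
_IsSubgraphOf_ {m} {n} H G =
  Data.Product.Σ (Fin m → Fin n) λ f →
    Injective _≡_ _≡_ f × (∀ i j → adj H i j ≡ true → adj G (f i) (f j) ≡ true)

-- Let f : V(H) → V(G) be injective and send edges to edges, and write f(e) for the
-- image of an edge e of H.  For a maximal matching M of H the edges f(M) form a
-- matching of G; extend it greedily (scan E(G), keep every edge meeting no kept edge)
-- to a maximal matching φ(M) of G.  The map φ is injective on maximal matchings of H:
-- by maximality each edge e of H meets some g ∈ M, and if moreover f(e) ∈ φ(M) with
-- e ≠ g, then f(e) and f(g) would be distinct edges of the matching φ(M), hence
-- disjoint, hence e and g disjoint.  So M = {e ∈ E(H) | f(e) ∈ φ(M)}, and counting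
-- the injection φ gives Ψ(H) ≤ Ψ(G).

module Submission where

open import Defs
open import Data.Nat using (ℕ; suc; _≤_; z≤n; s≤s)
open import Data.Nat.Properties using (module ≤-Reasoning)
open import Data.Bool using (true)
open import Data.Bool.Properties using () renaming (_≟_ to _≟B_)
open import Data.Fin using (Fin; _<_; _<?_)
open import Data.Fin.Properties using (<-cmp; <⇒≢; <-asym) renaming (_≟_ to _≟F_)
open import Data.Product using (_×_; _,_; proj₁; proj₂; swap)
open import Data.Product.Properties using (≡-dec; ×-≡,≡←≡)
open import Data.Sum using (_⊎_; inj₁; inj₂; [_,_]′)
import Data.Sum as Sum
open import Data.Empty using (⊥-elim)
open import Data.List using (List; []; _∷_; map; _++_; filter; length; allFin; cartesianProduct)
open import Data.List.Properties using (length-map; length-++-sucʳ; ∷-injectiveʳ)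
open import Data.List.Relation.Unary.All as All using (All; []; _∷_)
import Data.List.Relation.Unary.All.Properties as AllP
open import Data.List.Relation.Unary.Any as Any using (Any; here; there)
open import Data.List.Relation.Unary.AllPairs as AllPairs using (AllPairs; []; _∷_)
import Data.List.Relation.Unary.AllPairs.Properties as AllPairsP
open import Data.List.Relation.Unary.Unique.Propositional using (Unique)
import Data.List.Relation.Unary.Unique.Propositional.Properties as UniqueP
open import Data.List.Membership.Propositional using (_∈_; find; lose)
open import Data.List.Membership.Propositional.Properties
  using (∈-map⁺; ∈-map⁻; ∈-++⁺ˡ; ∈-++⁺ʳ; ∈-++⁻; ∈-filter⁺; ∈-filter⁻; ∈-∃++; ∈-allFin; ∈-cartesianProduct⁺)
import Data.List.Membership.DecPropositional as DecMembership
open import Relation.Nullary using (Dec; yes; no; ¬_; ¬?; _×-dec_)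
open import Relation.Nullary.Decidable using (decidable-stable)
open import Relation.Binary using (DecidableEquality; tri<; tri≈; tri>)
open import Relation.Binary.PropositionalEquality using (_≡_; _≢_; refl; sym; trans; cong; cong₂; subst)
open import Function using (Injective; _∘_; id)

module _ {A : Set} where

  AllPairs-lookup : {R : A → A → Set} {xs : List A} {x y : A} → AllPairs R xs →
                    x ∈ xs → y ∈ xs → x ≢ y → R x y ⊎ R y x
  AllPairs-lookup _         (here refl) (here refl) x≢y = ⊥-elim (x≢y refl)
  AllPairs-lookup (rx ∷ _)  (here refl) (there y∈) _   = inj₁ (All.lookup rx y∈)
  AllPairs-lookup (ry ∷ _)  (there x∈)  (here refl) _  = inj₂ (All.lookup ry x∈)
  AllPairs-lookup (_ ∷ rxs) (there x∈)  (there y∈) x≢y = AllPairs-lookup rxs x∈ y∈ x≢y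

  AllPairs-tabulate : {R : A → A → Set} {ys : List A} → Unique ys →
                      (∀ {x y} → x ∈ ys → y ∈ ys → x ≢ y → R x y) → AllPairs R ys
  AllPairs-tabulate [] _ = []
  AllPairs-tabulate (y∉ys ∷ u) rel =
    All.tabulate (λ x∈ → rel (here refl) (there x∈) (All.lookup y∉ys x∈))
      ∷ AllPairs-tabulate u (λ x∈ y∈ → rel (there x∈) (there y∈))

  AllPairs-⊆ : {R : A → A → Set} {xs ys : List A} → (∀ {x y} → R x y → R y x) →
               Unique ys → AllPairs R xs → (∀ {z} → z ∈ ys → z ∈ xs) → AllPairs R ys
  AllPairs-⊆ R-sym u rel ys⊆xs = AllPairs-tabulate u λ x∈ y∈ x≢y →
    [ id , R-sym ]′ (AllPairs-lookup rel (ys⊆xs x∈) (ys⊆xs y∈) x≢y)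

  Unique-⊆-length : {xs ys : List A} → Unique xs → (∀ {z} → z ∈ xs → z ∈ ys) →
                    length xs ≤ length ys
  Unique-⊆-length {[]} _ _ = z≤n
  Unique-⊆-length {x ∷ xs} (x∉xs ∷ u) sub with ∈-∃++ (sub (here refl))
  ... | ys₁ , ys₂ , refl = begin
      length (x ∷ xs)           ≤⟨ s≤s (Unique-⊆-length u (λ z∈ → drop-x (sub (there z∈)) (x≢ z∈))) ⟩
      suc (length (ys₁ ++ ys₂)) ≡⟨ sym (length-++-sucʳ ys₁ x ys₂) ⟩
      length (ys₁ ++ x ∷ ys₂)   ∎
    where
    open ≤-Reasoning
    x≢ : ∀ {z} → z ∈ xs → z ≢ x
    x≢ z∈ = All.lookup x∉xs z∈ ∘ sym
    drop-x : ∀ {z} → z ∈ ys₁ ++ x ∷ ys₂ → z ≢ x → z ∈ ys₁ ++ ys₂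
    drop-x z∈ z≢x with ∈-++⁻ ys₁ z∈
    ... | inj₁ z∈ys₁         = ∈-++⁺ˡ z∈ys₁
    ... | inj₂ (here refl)   = ⊥-elim (z≢x refl)
    ... | inj₂ (there z∈ys₂) = ∈-++⁺ʳ ys₁ z∈ys₂

  ∈-sublists⇒⊆ : {xs s : List A} → s ∈ sublists xs → ∀ {x} → x ∈ s → x ∈ xs
  ∈-sublists⇒⊆ {[]} (here refl) ()
  ∈-sublists⇒⊆ {y ∷ xs} s∈ x∈s with ∈-++⁻ (sublists xs) s∈
  ... | inj₁ s∈′ = there (∈-sublists⇒⊆ s∈′ x∈s)
  ... | inj₂ s∈′ with ∈-map⁻ (y ∷_) s∈′ | x∈s
  ...   | _ , _ , refl     | here refl = here refl
  ...   | _ , t∈ , refl   | there x∈t = there (∈-sublists⇒⊆ t∈ x∈t)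

  ∉-sublists : {x : A} {xs s : List A} → All (x ≢_) xs → s ∈ sublists xs → ¬ x ∈ s
  ∉-sublists x∉xs s∈ x∈s = All.lookup x∉xs (∈-sublists⇒⊆ s∈ x∈s) refl

  filter∈sublists : {P : A → Set} (P? : ∀ x → Dec (P x)) (xs : List A) → filter P? xs ∈ sublists xs
  filter∈sublists P? [] = here refl
  filter∈sublists P? (x ∷ xs) with P? x
  ... | yes _ = ∈-++⁺ʳ (sublists xs) (∈-map⁺ (x ∷_) (filter∈sublists P? xs))
  ... | no  _ = ∈-++⁺ˡ (filter∈sublists P? xs)

  sublists-Unique : {xs : List A} → Unique xs → Unique (sublists xs)
  sublists-Unique {[]} _ = [] ∷ []
  sublists-Unique {x ∷ xs} (x∉xs ∷ u) =
    UniqueP.++⁺ (sublists-Unique u) (UniqueP.map⁺ ∷-injectiveʳ (sublists-Unique u)) apart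
    where
    apart : ∀ {s} → ¬ (s ∈ sublists xs × s ∈ map (x ∷_) (sublists xs))
    apart (s∈ , s∈′) with ∈-map⁻ (x ∷_) s∈′
    ... | _ , _ , refl = ∉-sublists x∉xs s∈ (here refl)

  sublists-ext : {xs s₁ s₂ : List A} → Unique xs → s₁ ∈ sublists xs → s₂ ∈ sublists xs →
                 (∀ {y} → y ∈ xs → y ∈ s₁ → y ∈ s₂) → (∀ {y} → y ∈ xs → y ∈ s₂ → y ∈ s₁) →
                 s₁ ≡ s₂
  sublists-ext {[]} _ (here refl) (here refl) _ _ = refl
  sublists-ext {x ∷ xs} (x∉xs ∷ u) s₁∈ s₂∈ to from
    with ∈-++⁻ (sublists xs) s₁∈ | ∈-++⁻ (sublists xs) s₂∈
  ... | inj₁ t₁∈ | inj₁ t₂∈ = sublists-ext u t₁∈ t₂∈ (to ∘ there) (from ∘ there)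
  ... | inj₁ t₁∈ | inj₂ t₂∈ with ∈-map⁻ (x ∷_) t₂∈
  ...   | _ , _ , refl = ⊥-elim (∉-sublists x∉xs t₁∈ (from (here refl) (here refl)))
  sublists-ext {x ∷ xs} (x∉xs ∷ u) _ _ to from | inj₂ t₁∈ | inj₁ t₂∈ with ∈-map⁻ (x ∷_) t₁∈
  ...   | _ , _ , refl = ⊥-elim (∉-sublists x∉xs t₂∈ (to (here refl) (here refl)))
  sublists-ext {x ∷ xs} (x∉xs ∷ u) _ _ to from | inj₂ t₁∈ | inj₂ t₂∈
    with ∈-map⁻ (x ∷_) t₁∈ | ∈-map⁻ (x ∷_) t₂∈
  ...   | _ , t₁∈′ , refl | _ , t₂∈′ , refl =
    cong (x ∷_) (sublists-ext u t₁∈′ t₂∈′ (λ y∈ → tail y∈ ∘ to (there y∈) ∘ there)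
                                          (λ y∈ → tail y∈ ∘ from (there y∈) ∘ there))
    where
    tail : ∀ {y t} → y ∈ xs → y ∈ x ∷ t → y ∈ t
    tail y∈ (here refl) = ⊥-elim (All.lookup x∉xs y∈ refl)
    tail _  (there y∈t) = y∈t

module _ {A B : Set} where

  injection-length : (φ : A → B) {xs : List A} {ys : List B} → Unique xs →
                     (∀ {x} → x ∈ xs → φ x ∈ ys) →
                     (∀ {x y} → x ∈ xs → y ∈ xs → φ x ≡ φ y → x ≡ y) →
                     length xs ≤ length ys
  injection-length φ {xs} {ys} u into inj = begin
      length xs         ≡⟨ sym (length-map φ xs) ⟩
      length (map φ xs) ≤⟨ Unique-⊆-length (image-Unique u inj) image⊆ys ⟩
      length ys         ∎
    where
    open ≤-Reasoning
    image-Unique : ∀ {zs} → Unique zs → (∀ {x y} → x ∈ zs → y ∈ zs → φ x ≡ φ y → x ≡ y) →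
                   Unique (map φ zs)
    image-Unique [] _ = []
    image-Unique (z∉ ∷ u′) inj′ =
      AllP.map⁺ (All.tabulate (λ x∈ eq → All.lookup z∉ x∈ (inj′ (here refl) (there x∈) eq)))
        ∷ image-Unique u′ (λ x∈ y∈ → inj′ (there x∈) (there y∈))
    image⊆ys : ∀ {z} → z ∈ map φ xs → z ∈ ys
    image⊆ys z∈ with ∈-map⁻ φ z∈
    ... | x , x∈ , refl = into x∈

-- The members of a list S, listed in the order of xs: a canonical representative of
-- the finite set S ∩ xs among the sublists of xs.
module Restrict {A : Set} (_≟_ : DecidableEquality A) where

  open DecMembership _≟_ using (_∈?_)

  restrict : List A → List A → List A
  restrict xs S = filter (_∈? S) xs

  restrict∈sublists : ∀ xs S → restrict xs S ∈ sublists xs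
  restrict∈sublists xs S = filter∈sublists (_∈? S) xs

  restrict-Unique : ∀ {xs} S → Unique xs → Unique (restrict xs S)
  restrict-Unique S = UniqueP.filter⁺ (_∈? S)

  ∈-restrict⁻ : ∀ {x} xs {S} → x ∈ restrict xs S → x ∈ S
  ∈-restrict⁻ xs {S} = proj₂ ∘ ∈-filter⁻ (_∈? S) {xs = xs}

  ∈-restrict⁺ : ∀ {x xs S} → x ∈ xs → x ∈ S → x ∈ restrict xs S
  ∈-restrict⁺ {S = S} = ∈-filter⁺ (_∈? S)

module Greedy {A : Set} {R : A → A → Set} (R? : ∀ x y → Dec (R x y)) where

  Clash : A → List A → Set
  Clash x S = Any (λ y → ¬ R x y) S

  clash? : ∀ x S → Dec (Clash x S)
  clash? x S = Any.any? (λ y → ¬? (R? x y)) S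

  extend : List A → List A → List A
  extend acc []       = acc
  extend acc (x ∷ xs) with clash? x acc
  ... | yes _ = extend acc xs
  ... | no  _ = extend (x ∷ acc) xs

  ¬Clash⇒All : ∀ {x} S → ¬ Clash x S → All (R x) S
  ¬Clash⇒All {x} S noClash = All.map (decidable-stable (R? x _)) (AllP.¬Any⇒All¬ S noClash)

  extend-pairwise : ∀ {acc} xs → AllPairs R acc → AllPairs R (extend acc xs)
  extend-pairwise []       rel = rel
  extend-pairwise {acc} (x ∷ xs) rel with clash? x acc
  ... | yes _       = extend-pairwise xs rel
  ... | no noClash  = extend-pairwise xs (¬Clash⇒All acc noClash ∷ rel)

  extend-⊇ : ∀ {acc} xs {y} → y ∈ acc → y ∈ extend acc xs
  extend-⊇ []       y∈ = y∈
  extend-⊇ {acc} (x ∷ xs) y∈ with clash? x acc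
  ... | yes _ = extend-⊇ xs y∈
  ... | no  _ = extend-⊇ xs (there y∈)

  extend-⊆ : ∀ {acc} xs {y} → y ∈ extend acc xs → y ∈ acc ⊎ y ∈ xs
  extend-⊆ []       y∈ = inj₁ y∈
  extend-⊆ {acc} (x ∷ xs) y∈ with clash? x acc
  ... | yes _ = Sum.map₂ there (extend-⊆ xs y∈)
  ... | no  _ with extend-⊆ xs y∈
  ...   | inj₁ (here refl) = inj₂ (here refl)
  ...   | inj₁ (there y∈acc) = inj₁ y∈acc
  ...   | inj₂ y∈xs = inj₂ (there y∈xs)

  -- For irreflexive R, every scanned element clashes with the result (a kept
  -- element clashes with itself).
  extend-clash : (∀ {x} → ¬ R x x) → ∀ {acc} xs {x} → x ∈ xs → Clash x (extend acc xs)
  extend-clash irrefl {acc} (x ∷ xs) x∈ with clash? x acc | x∈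
  ... | yes clash | here refl  = let g , g∈ , ¬Rxg = find clash in lose (extend-⊇ xs g∈) ¬Rxg
  ... | yes _     | there x∈xs = extend-clash irrefl xs x∈xs
  ... | no  _     | here refl  = lose (extend-⊇ xs (here refl)) irrefl
  ... | no  _     | there x∈xs = extend-clash irrefl xs x∈xs

module _ {n : ℕ} where

  decEdge : DecidableEquality (Edge n)
  decEdge = ≡-dec _≟F_ _≟F_

  Disjoint-sym : ∀ {e g : Edge n} → Disjoint e g → Disjoint g e
  Disjoint-sym (a≢c , a≢d , b≢c , b≢d) = a≢c ∘ sym , b≢c ∘ sym , a≢d ∘ sym , b≢d ∘ sym

  Disjoint-irrefl : ∀ {e : Edge n} → ¬ Disjoint e e
  Disjoint-irrefl (a≢a , _) = a≢a refl

  Disjoint-swapˡ : ∀ {a b : Fin n} {g : Edge n} → Disjoint (a , b) g → Disjoint (b , a) g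
  Disjoint-swapˡ (a≢c , a≢d , b≢c , b≢d) = b≢c , b≢d , a≢c , a≢d

  orient : Fin n → Fin n → Edge n
  orient x y with x <? y
  ... | yes _ = (x , y)
  ... | no  _ = (y , x)

  orient-cases : ∀ x y → orient x y ≡ (x , y) ⊎ orient x y ≡ (y , x)
  orient-cases x y with x <? y
  ... | yes _ = inj₁ refl
  ... | no  _ = inj₂ refl

  orient-disjoint : ∀ {x y} {g : Edge n} → Disjoint (x , y) g → Disjoint (orient x y) g
  orient-disjoint {x} {y} d with orient-cases x y
  ... | inj₁ eq rewrite eq = d
  ... | inj₂ eq rewrite eq = Disjoint-swapˡ d

  orient-disjoint⁻ : ∀ {x y} {g : Edge n} → Disjoint (orient x y) g → Disjoint (x , y) g
  orient-disjoint⁻ {x} {y} d with orient-cases x y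
  ... | inj₁ eq rewrite eq = d
  ... | inj₂ eq rewrite eq = Disjoint-swapˡ d

  orient-injective : ∀ {x y z w} → orient x y ≡ orient z w → (x ≡ z × y ≡ w) ⊎ (x ≡ w × y ≡ z)
  orient-injective {x} {y} {z} {w} eq with orient-cases x y | orient-cases z w
  ... | inj₁ p | inj₁ q = inj₁ (×-≡,≡←≡ (trans (sym p) (trans eq q)))
  ... | inj₁ p | inj₂ q = inj₂ (×-≡,≡←≡ (trans (sym p) (trans eq q)))
  ... | inj₂ p | inj₁ q = inj₂ (swap (×-≡,≡←≡ (trans (sym p) (trans eq q))))
  ... | inj₂ p | inj₂ q = inj₁ (swap (×-≡,≡←≡ (trans (sym p) (trans eq q))))

  isEdge? : (G : Graph n) (e : Edge n) → Dec ((proj₁ e < proj₂ e) × (adj G (proj₁ e) (proj₂ e) ≡ true))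
  isEdge? G e = (proj₁ e <? proj₂ e) ×-dec (adj G (proj₁ e) (proj₂ e) ≟B true)

  ∈-edges⁻ : (G : Graph n) {e : Edge n} → e ∈ edges G →
             (proj₁ e < proj₂ e) × (adj G (proj₁ e) (proj₂ e) ≡ true)
  ∈-edges⁻ G = proj₂ ∘ ∈-filter⁻ (isEdge? G) {xs = cartesianProduct (allFin n) (allFin n)}

  ∈-edges⁺ : (G : Graph n) {x y : Fin n} → x ≢ y → adj G x y ≡ true → orient x y ∈ edges G
  ∈-edges⁺ G {x} {y} x≢y xy with x <? y
  ... | yes x<y = ∈-filter⁺ (isEdge? G) (∈-cartesianProduct⁺ (∈-allFin x) (∈-allFin y)) (x<y , xy)
  ... | no  x≮y with <-cmp x y
  ...   | tri< x<y _ _ = ⊥-elim (x≮y x<y)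
  ...   | tri≈ _ x≡y _ = ⊥-elim (x≢y x≡y)
  ...   | tri> _ _ y<x = ∈-filter⁺ (isEdge? G) (∈-cartesianProduct⁺ (∈-allFin y) (∈-allFin x))
                                    (y<x , trans (symm G y x) xy)

  edges-Unique : (G : Graph n) → Unique (edges G)
  edges-Unique G = UniqueP.filter⁺ (isEdge? G) {cartesianProduct (allFin n) (allFin n)}
                     (UniqueP.cartesianProduct⁺ (UniqueP.allFin⁺ n) (UniqueP.allFin⁺ n))

module _ {n : ℕ} where
  open Greedy (disjoint? {n}) public

module _ {n : ℕ} (G : Graph n) where

  open Restrict (decEdge {n})

  Dominates : List (Edge n) → Set
  Dominates M = ∀ {e} → e ∈ edges G → Clash e M

  dominating-matching⇒maximal : ∀ {M} → IsMatching M → Dominates M → IsMaximalMatching G M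
  dominating-matching⇒maximal {M} matching dominates = matching , All.tabulate maximal
    where
    maximal : ∀ {M′} → M′ ∈ sublists (edges G) → IsMatching M′ → M ⊆E M′ → M′ ⊆E M
    maximal {M′} M′⊆E matching′ M⊆M′ = All.tabulate covered
      where
      covered : ∀ {e} → e ∈ M′ → e ∈ M
      covered {e} e∈M′ with find (dominates (∈-sublists⇒⊆ M′⊆E e∈M′))
      ... | g , g∈M , e∦g with decEdge e g
      ...   | yes refl = g∈M
      ...   | no  e≢g  = ⊥-elim ([ e∦g , e∦g ∘ Disjoint-sym ]′
                           (AllPairs-lookup matching′ e∈M′ (All.lookup M⊆M′ g∈M) e≢g))

  -- Conversely, a maximal matching meets every edge: otherwise the edge could be
  -- added, and the enlarged matching (in canonical order) would contradict maximality.
  maximal⇒dominating : ∀ {M} → M ∈ sublists (edges G) → IsMaximalMatching G M → Dominates M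
  maximal⇒dominating {M} M⊆E (matching , maximal) {e} e∈E with clash? e M
  ... | yes clash   = clash
  ... | no  noClash = lose (All.lookup M⁺⊆M e∈M⁺) Disjoint-irrefl
    where
    M⁺ : List (Edge n)
    M⁺ = restrict (edges G) (e ∷ M)
    e∷M-matching : IsMatching (e ∷ M)
    e∷M-matching = ¬Clash⇒All M noClash ∷ matching
    M⁺⊆M : M⁺ ⊆E M
    M⁺⊆M = All.lookup maximal (restrict∈sublists (edges G) (e ∷ M))
             (AllPairs-⊆ Disjoint-sym (restrict-Unique (e ∷ M) (edges-Unique G)) e∷M-matching
                         (∈-restrict⁻ (edges G)))
             (All.tabulate (λ g∈M → ∈-restrict⁺ (∈-sublists⇒⊆ {xs = edges G} M⊆E g∈M) (there g∈M)))
    e∈M⁺ : e ∈ M⁺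
    e∈M⁺ = ∈-restrict⁺ e∈E (here refl)

MaximalMatchings : ∀ {k} → Graph k → List (List (Edge k))
MaximalMatchings K = filter (isMaximalMatching? K) (sublists (edges K))

∈-MaximalMatchings⁻ : ∀ {k} (K : Graph k) {M} → M ∈ MaximalMatchings K →
                      M ∈ sublists (edges K) × IsMaximalMatching K M
∈-MaximalMatchings⁻ K = ∈-filter⁻ (isMaximalMatching? K) {xs = sublists (edges K)}

module Embedding {m n : ℕ} (H : Graph m) (G : Graph n) (f : Fin m → Fin n)
                 (f-injective : Injective _≡_ _≡_ f)
                 (f-adj : ∀ i j → adj H i j ≡ true → adj G (f i) (f j) ≡ true) where

  open Restrict (decEdge {n})

  image : Edge m → Edge n
  image (a , b) = orient (f a) (f b)

  image-edge : ∀ {e} → e ∈ edges H → image e ∈ edges G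
  image-edge {a , b} e∈E with ∈-edges⁻ H e∈E
  ... | a<b , ab = ∈-edges⁺ G (<⇒≢ a<b ∘ f-injective) (f-adj a b ab)

  image-injective : ∀ {e g} → e ∈ edges H → g ∈ edges H → image e ≡ image g → e ≡ g
  image-injective {a , b} {c , d} e∈E g∈E eq with orient-injective eq
  ... | inj₁ (fa≡fc , fb≡fd) = cong₂ _,_ (f-injective fa≡fc) (f-injective fb≡fd)
  ... | inj₂ (fa≡fd , fb≡fc) with f-injective fa≡fd | f-injective fb≡fc
  ...   | refl | refl = ⊥-elim (<-asym (proj₁ (∈-edges⁻ H e∈E)) (proj₁ (∈-edges⁻ H g∈E)))

  image-disjoint : ∀ {e g} → Disjoint e g → Disjoint (image e) (image g)
  image-disjoint (a≢c , a≢d , b≢c , b≢d) =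
    orient-disjoint (Disjoint-sym (orient-disjoint (Disjoint-sym
      (a≢c ∘ f-injective , a≢d ∘ f-injective , b≢c ∘ f-injective , b≢d ∘ f-injective))))

  image-disjoint⁻ : ∀ {e g} → Disjoint (image e) (image g) → Disjoint e g
  image-disjoint⁻ d with orient-disjoint⁻ (Disjoint-sym (orient-disjoint⁻ (Disjoint-sym d)))
  ... | fa≢fc , fa≢fd , fb≢fc , fb≢fd = fa≢fc ∘ cong f , fa≢fd ∘ cong f , fb≢fc ∘ cong f , fb≢fd ∘ cong f

  φ : List (Edge m) → List (Edge n)
  φ M = restrict (edges G) (extend (map image M) (edges G))

  module _ {M : List (Edge m)} (M⊆E : M ∈ sublists (edges H)) where

    kept∈φ : ∀ {e} → e ∈ extend (map image M) (edges G) → e ∈ φ M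
    kept∈φ e∈ = ∈-restrict⁺ ([ fromImage , id ]′ (extend-⊆ (edges G) e∈)) e∈
      where
      fromImage : ∀ {e} → e ∈ map image M → e ∈ edges G
      fromImage e∈ with ∈-map⁻ image e∈
      ... | g , g∈M , refl = image-edge (∈-sublists⇒⊆ M⊆E g∈M)

    image∈φ : ∀ {e} → e ∈ M → image e ∈ φ M
    image∈φ e∈M = kept∈φ (extend-⊇ (edges G) (∈-map⁺ image e∈M))

    φ-maximal : IsMatching M → IsMaximalMatching G (φ M)
    φ-maximal matching = dominating-matching⇒maximal G φ-matching φ-dominates
      where
      φ-matching : IsMatching (φ M)
      φ-matching = AllPairs-⊆ Disjoint-sym (restrict-Unique _ (edges-Unique G))
        (extend-pairwise (edges G) (AllPairsP.map⁺ (AllPairs.map image-disjoint matching)))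
        (∈-restrict⁻ (edges G))
      φ-dominates : Dominates G (φ M)
      φ-dominates e∈E = let g , g∈ , e∦g = find (extend-clash Disjoint-irrefl (edges G) e∈E)
                        in lose (kept∈φ g∈) e∦g

    φ-reflects : IsMaximalMatching H M → ∀ {e} → e ∈ edges H → image e ∈ φ M → e ∈ M
    φ-reflects maximal@(matching , _) {e} e∈E fe∈φ
      with find (maximal⇒dominating H M⊆E maximal e∈E)
    ... | g , g∈M , e∦g with decEdge e g
    ...   | yes refl = g∈M
    ...   | no  e≢g  = ⊥-elim ([ e∦g , e∦g ∘ Disjoint-sym ]′
              (Sum.map image-disjoint⁻ image-disjoint⁻
                (AllPairs-lookup (proj₁ (φ-maximal matching)) fe∈φ (image∈φ g∈M)
                                 (e≢g ∘ image-injective e∈E (∈-sublists⇒⊆ M⊆E g∈M)))))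

  φ-injective : ∀ {M₁ M₂} → M₁ ∈ MaximalMatchings H → M₂ ∈ MaximalMatchings H →
                φ M₁ ≡ φ M₂ → M₁ ≡ M₂
  φ-injective M₁∈ M₂∈ eq with ∈-MaximalMatchings⁻ H M₁∈ | ∈-MaximalMatchings⁻ H M₂∈
  ... | M₁⊆E , max₁ | M₂⊆E , max₂ =
    sublists-ext (edges-Unique H) M₁⊆E M₂⊆E
      (λ e∈E e∈M₁ → φ-reflects M₂⊆E max₂ e∈E (subst (image _ ∈_) eq (image∈φ M₁⊆E e∈M₁)))
      (λ e∈E e∈M₂ → φ-reflects M₁⊆E max₁ e∈E (subst (image _ ∈_) (sym eq) (image∈φ M₂⊆E e∈M₂)))

  φ-maps-into : ∀ {M} → M ∈ MaximalMatchings H → φ M ∈ MaximalMatchings G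
  φ-maps-into M∈ with ∈-MaximalMatchings⁻ H M∈
  ... | M⊆E , (matching , _) =
    ∈-filter⁺ (isMaximalMatching? G) (restrict∈sublists (edges G) _) (φ-maximal M⊆E matching)

  Ψ-monotone : Ψ H ≤ Ψ G
  Ψ-monotone = injection-length φ
    (UniqueP.filter⁺ (isMaximalMatching? H) (sublists-Unique (edges-Unique H)))
    φ-maps-into φ-injective

mainTheorem4 : ∀ {m n} (H : Graph m) (G : Graph n) → H IsSubgraphOf G → Ψ H ≤ Ψ G
mainTheorem4 H G (f , f-injective , f-adj) = Embedding.Ψ-monotone H G f f-injective f-adj
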